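{- Let $(M,\sqcup,\sqcap)$ be a mixed lattice algebra. Then for all $x,y\in M$: (a) $x\sqcap x=x$ and $x\sqcup x=x$; (b) $x=y\sqcap x \iff y=x\sqcup y$, and $y=y\sqcap x\iff x=x\sqcup y$; (c) $x\sqcap(x\sqcap y)=x\sqcap y$ and $(x\sqcap y)\sqcap y=x\sqcap y$; (d) $x\sqcup(x\sqcup y)=x\sqcup y$ and $(x\sqcup y)\sqcup y=x\sqcup y$.
   Context: An algebra $(M,\sqcup,\sqcap)$, where $M$ is a set and $\sqcup,\sqcap$ are binary operations (not assumed commutative or associative), is called a mixed lattice algebra if for all $x,y,z\in M$: (M1) $x\sqcup y=x\sqcap y \iff x=y$; (M2a) $(x\sqcap y)\sqcup x=x$ and $(x\sqcup y)\sqcap x=x$; (M2b) $x\sqcup(y\sqcap x)=x$ and $x\sqcap(y\sqcup x)=x$; (M3a) $z\sqcap(x\sqcup y)=[z\sqcap(x\sqcup y)]\sqcup(z\sqcap y)$; (M3b) $z\sqcup(x\sqcap y)=[z\sqcup(x\sqcap y)]\sqcap(z\sqcup y)$; (M4a) $(x\sqcup y)\sqcap z=[(x\sqcup y)\sqcap z]\sqcup(x\sqcap z)$; (M4b) $(x\sqcap y)\sqcup z=[(x\sqcap y)\sqcup z]\sqcap(x\sqcup z)$. -}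

module Defs where

open import Level using (Level)
open import Relation.Binary.PropositionalEquality using (_≡_)
open import Data.Product using (_×_)
open import Function.Bundles using (_⇔_)

record IsMixedLatticeAlgebra {a : Level} (M : Set a)
                             (_⊔_ _⊓_ : M → M → M) : Set a where
  field
    M1  : ∀ x y → ((x ⊔ y) ≡ (x ⊓ y)) ⇔ (x ≡ y)
    M2a : ∀ x y → ((x ⊓ y) ⊔ x ≡ x) × ((x ⊔ y) ⊓ x ≡ x)
    M2b : ∀ x y → (x ⊔ (y ⊓ x) ≡ x) × (x ⊓ (y ⊔ x) ≡ x)
    M3a : ∀ x y z → z ⊓ (x ⊔ y) ≡ (z ⊓ (x ⊔ y)) ⊔ (z ⊓ y)
    M3b : ∀ x y z → z ⊔ (x ⊓ y) ≡ (z ⊔ (x ⊓ y)) ⊓ (z ⊔ y)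
    M4a : ∀ x y z → (x ⊔ y) ⊓ z ≡ ((x ⊔ y) ⊓ z) ⊔ (x ⊓ z)
    M4b : ∀ x y z → (x ⊓ y) ⊔ z ≡ ((x ⊓ y) ⊔ z) ⊓ (x ⊔ z)

module Submission where

open import Defs
open import Level using (Level)
open import Relation.Binary.PropositionalEquality using (_≡_; sym; cong; module ≡-Reasoning)
open import Data.Product using (_×_; _,_; proj₁; proj₂)
open import Function.Bundles using (_⇔_; mk⇔; module Equivalence)

-- Only the absorption laws (M2a) and (M2b) are needed.
module MixedLatticeAlgebraProperties
  {a : Level} {M : Set a} {_⊔_ _⊓_ : M → M → M}
  (isMLA : IsMixedLatticeAlgebra M _⊔_ _⊓_) where

  open IsMixedLatticeAlgebra isMLA
  open ≡-Reasoning

  ⊓-absorbs-⊔ˡ : ∀ x y → (x ⊓ y) ⊔ x ≡ x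
  ⊓-absorbs-⊔ˡ x y = proj₁ (M2a x y)

  ⊔-absorbs-⊓ˡ : ∀ x y → (x ⊔ y) ⊓ x ≡ x
  ⊔-absorbs-⊓ˡ x y = proj₂ (M2a x y)

  ⊓-absorbs-⊔ʳ : ∀ x y → x ⊔ (y ⊓ x) ≡ x
  ⊓-absorbs-⊔ʳ x y = proj₁ (M2b x y)

  ⊔-absorbs-⊓ʳ : ∀ x y → x ⊓ (y ⊔ x) ≡ x
  ⊔-absorbs-⊓ʳ x y = proj₂ (M2b x y)

  ⊓-idem : ∀ x → x ⊓ x ≡ x
  ⊓-idem x = begin
    x ⊓ x             ≡⟨ cong (x ⊓_) (sym (⊓-absorbs-⊔ˡ x x)) ⟩
    x ⊓ ((x ⊓ x) ⊔ x) ≡⟨ ⊔-absorbs-⊓ʳ x (x ⊓ x) ⟩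
    x                 ∎

  ⊔-idem : ∀ x → x ⊔ x ≡ x
  ⊔-idem x = begin
    x ⊔ x             ≡⟨ cong (x ⊔_) (sym (⊔-absorbs-⊓ˡ x x)) ⟩
    x ⊔ ((x ⊔ x) ⊓ x) ≡⟨ ⊓-absorbs-⊔ʳ x (x ⊔ x) ⟩
    x                 ∎

  ⊓-fixedˡ⇔⊔-fixedʳ : ∀ x y → (x ≡ y ⊓ x) ⇔ (y ≡ x ⊔ y)
  ⊓-fixedˡ⇔⊔-fixedʳ x y = mk⇔ to from
    where
    to : x ≡ y ⊓ x → y ≡ x ⊔ y
    to x≡y⊓x = sym (begin
      x ⊔ y       ≡⟨ cong (_⊔ y) x≡y⊓x ⟩
      (y ⊓ x) ⊔ y ≡⟨ ⊓-absorbs-⊔ˡ y x ⟩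
      y           ∎)
    from : y ≡ x ⊔ y → x ≡ y ⊓ x
    from y≡x⊔y = sym (begin
      y ⊓ x       ≡⟨ cong (_⊓ x) y≡x⊔y ⟩
      (x ⊔ y) ⊓ x ≡⟨ ⊔-absorbs-⊓ˡ x y ⟩
      x           ∎)

  ⊓-fixedʳ⇔⊔-fixedˡ : ∀ x y → (y ≡ y ⊓ x) ⇔ (x ≡ x ⊔ y)
  ⊓-fixedʳ⇔⊔-fixedˡ x y = mk⇔ to from
    where
    to : y ≡ y ⊓ x → x ≡ x ⊔ y
    to y≡y⊓x = sym (begin
      x ⊔ y       ≡⟨ cong (x ⊔_) y≡y⊓x ⟩
      x ⊔ (y ⊓ x) ≡⟨ ⊓-absorbs-⊔ʳ x y ⟩
      x           ∎)
    from : x ≡ x ⊔ y → y ≡ y ⊓ x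
    from x≡x⊔y = sym (begin
      y ⊓ x       ≡⟨ cong (y ⊓_) x≡x⊔y ⟩
      y ⊓ (x ⊔ y) ≡⟨ ⊔-absorbs-⊓ʳ y x ⟩
      y           ∎)

  -- Each of these is an absorption law read backwards through one of the two equivalences above.
  ⊓-idem-nestedˡ : ∀ x y → x ⊓ (x ⊓ y) ≡ x ⊓ y
  ⊓-idem-nestedˡ x y =
    sym (Equivalence.from (⊓-fixedˡ⇔⊔-fixedʳ (x ⊓ y) x) (sym (⊓-absorbs-⊔ˡ x y)))

  ⊓-idem-nestedʳ : ∀ x y → (x ⊓ y) ⊓ y ≡ x ⊓ y
  ⊓-idem-nestedʳ x y =
    sym (Equivalence.from (⊓-fixedʳ⇔⊔-fixedˡ y (x ⊓ y)) (sym (⊓-absorbs-⊔ʳ y x)))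

  ⊔-idem-nestedˡ : ∀ x y → x ⊔ (x ⊔ y) ≡ x ⊔ y
  ⊔-idem-nestedˡ x y =
    sym (Equivalence.to (⊓-fixedˡ⇔⊔-fixedʳ x (x ⊔ y)) (sym (⊔-absorbs-⊓ˡ x y)))

  ⊔-idem-nestedʳ : ∀ x y → (x ⊔ y) ⊔ y ≡ x ⊔ y
  ⊔-idem-nestedʳ x y =
    sym (Equivalence.to (⊓-fixedʳ⇔⊔-fixedˡ (x ⊔ y) y) (sym (⊔-absorbs-⊓ʳ y x)))

theorem3p3 : {a : Level} (M : Set a) (_⊔_ _⊓_ : M → M → M) →
    IsMixedLatticeAlgebra M _⊔_ _⊓_ →
    ∀ x y →
      ((x ⊓ x ≡ x) × (x ⊔ x ≡ x))
      × (((x ≡ y ⊓ x) ⇔ (y ≡ x ⊔ y)) × ((y ≡ y ⊓ x) ⇔ (x ≡ x ⊔ y)))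
      × ((x ⊓ (x ⊓ y) ≡ x ⊓ y) × ((x ⊓ y) ⊓ y ≡ x ⊓ y))
      × ((x ⊔ (x ⊔ y) ≡ x ⊔ y) × ((x ⊔ y) ⊔ y ≡ x ⊔ y))
theorem3p3 M _⊔_ _⊓_ isMLA x y =
    (⊓-idem x , ⊔-idem x)
  , (⊓-fixedˡ⇔⊔-fixedʳ x y , ⊓-fixedʳ⇔⊔-fixedˡ x y)
  , (⊓-idem-nestedˡ x y , ⊓-idem-nestedʳ x y)
  , (⊔-idem-nestedˡ x y , ⊔-idem-nestedʳ x y)
  where open MixedLatticeAlgebraProperties isMLA
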